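{- Let $s\ge 3$, let $F_{s-1}$ be the free group on $x_1,\dots,x_{s-1}$, let $R_0$ be the kernel of the homomorphism $\alpha:F_{s-1}\to\mathbb{Z}$ with $\alpha(x_j)=1$ for all $j$, and let $R_0^{\mathrm{ab}}=R_0/R_0'$. Let the braid generators $\sigma_1,\dots,\sigma_{s-2}$ act on $F_{s-1}$ by the Artin representation: $\sigma_i(x_k)=x_k$ for $k\ne i,i+1$, $\sigma_i(x_i)=x_ix_{i+1}x_i^{ -1}$, $\sigma_i(x_{i+1})=x_i$. These automorphisms preserve $R_0$ and hence act on $R_0^{\mathrm{ab}}$. Let $t$ act on $R_0^{\mathrm{ab}}$ by $a\mapsto a^t:=x_1ax_1^{ -1}$. Then the action of $t$ on $R_0^{\mathrm{ab}}$ commutes with the action of the braid group, i.e. $\sigma_j(a^t)=(\sigma_j(a))^t$ for all $a\in R_0^{\mathrm{ab}}$ and all $j$. -}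

module Defs where

open import Data.Nat using (ℕ; suc)
open import Data.Fin using (Fin; zero; suc; inject₁; _≟_)
open import Data.Bool using (Bool; true; false; not)
open import Data.Product using (_×_; _,_)
open import Data.List using (List; []; _∷_; _++_; map; reverse; concatMap)
open import Data.Integer using (ℤ; 0ℤ; 1ℤ; -1ℤ) renaming (_+_ to _+ℤ_)
open import Relation.Nullary using (yes; no)

-- Free group F_n on generators x_0 .. x_{n-1} (paper's x_1 .. x_n),
-- realised as words modulo free reduction.
-- A letter (g , true) is x_g, (g , false) is x_g⁻¹.
Letter : ℕ → Set
Letter n = Fin n × Bool

Word : ℕ → Set
Word n = List (Letter n)

invL : ∀ {n} → Letter n → Letter n
invL (g , b) = g , not b

_·_ : ∀ {n} → Word n → Word n → Word n
u · v = u ++ v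

infixr 6 _·_

_⁻¹ : ∀ {n} → Word n → Word n
w ⁻¹ = reverse (map invL w)

gen : ∀ {n} → Fin n → Word n
gen g = (g , true) ∷ []

data _≈_ {n : ℕ} : Word n → Word n → Set where
  ≈-refl   : ∀ {u} → u ≈ u
  ≈-sym    : ∀ {u v} → u ≈ v → v ≈ u
  ≈-trans  : ∀ {u v w} → u ≈ v → v ≈ w → u ≈ w
  ≈-cancel : ∀ u l v → (u ++ (l ∷ invL l ∷ v)) ≈ (u ++ v)

αL : ∀ {n} → Letter n → ℤ
αL (_ , true)  = 1ℤ
αL (_ , false) = -1ℤ

α : ∀ {n} → Word n → ℤ
α []       = 0ℤ
α (l ∷ w)  = αL l +ℤ α w

InR₀ : ∀ {n} → Word n → Set
InR₀ w = α w ≡ 0ℤ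
  where open import Relation.Binary.PropositionalEquality using (_≡_)

data InR₀' {n : ℕ} : Word n → Set where
  c-unit : InR₀' []
  c-comm : ∀ {a b} → InR₀ a → InR₀ b → InR₀' (a · b · a ⁻¹ · b ⁻¹)
  c-mul  : ∀ {u v} → InR₀' u → InR₀' v → InR₀' (u · v)
  c-inv  : ∀ {u} → InR₀' u → InR₀' (u ⁻¹)
  c-resp : ∀ {u v} → u ≈ v → InR₀' u → InR₀' v

-- equality in R₀^ab = R₀ / R₀' (for words representing elements of R₀)
_≈ab_ : ∀ {n} → Word n → Word n → Set
a ≈ab b = InR₀' (a · b ⁻¹)

applyHom : ∀ {n m} → (Fin n → Word m) → Word n → Word m
applyHom f []              = []
applyHom f ((g , true) ∷ w)  = f g · applyHom f w
applyHom f ((g , false) ∷ w) = (f g) ⁻¹ · applyHom f w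

-- Artin action on F_{s-1}, s = k + 3, generators Fin (suc (suc k)).
-- σ_i for i : Fin (suc k) (paper's σ_1 .. σ_{s-2});
-- paper's x_i is inject₁ i, x_{i+1} is suc i.
σimg : ∀ {k} → Fin (suc k) → Fin (suc (suc k)) → Word (suc (suc k))
σimg i g with g ≟ inject₁ i
... | yes _ = gen (inject₁ i) · gen (suc i) · (gen (inject₁ i)) ⁻¹
... | no _ with g ≟ suc i
...   | yes _ = gen (inject₁ i)
...   | no _  = gen g

σ : ∀ {k} → Fin (suc k) → Word (suc (suc k)) → Word (suc (suc k))
σ i = applyHom (σimg i)

tAct : ∀ {n} → Word (suc n) → Word (suc n)
tAct a = gen zero · a · (gen zero) ⁻¹

{-# OPTIONS --safe #-}
module Submission where

-- For j ≥ 2 the automorphism σ_j fixes x₁, so it commutes with t on the nose.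
-- σ₁ sends x₁ to x₁x₂x₁⁻¹ = g x₁ with g = x₁x₂x₁⁻¹x₁⁻¹, which lies in R₀;
-- hence σ₁(a^t) is the conjugate of (σ₁ a)^t by g, and conjugation by an
-- element of R₀ is trivial on R₀^ab since g q g⁻¹ q⁻¹ is a commutator in R₀.

open import Defs
open import Data.Nat using (ℕ; suc)
open import Data.Fin using (Fin; zero; suc; inject₁; _≟_)
open import Data.Bool using (true; false)
open import Data.Product using (_,_)
open import Data.List using ([]; _∷_; _++_; map)
open import Data.List.Properties using (++-assoc; ++-identityʳ; unfold-reverse)
open import Data.Integer using (0ℤ; 1ℤ; -_) renaming (_+_ to _+ℤ_)
open import Data.Integer.Properties using (neg-distrib-+; +-comm; +-assoc; +-identityʳ; +-identityˡ)
open import Relation.Nullary using (yes; no)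
open import Relation.Binary.PropositionalEquality

private
  variable
    n m : ℕ
    u v : Word n

≡⇒≈ : u ≡ v → u ≈ v
≡⇒≈ refl = ≈-refl

≈-context : (p q : Word n) → u ≈ v → (p ++ u ++ q) ≈ (p ++ v ++ q)
≈-context p q ≈-refl            = ≈-refl
≈-context p q (≈-sym e)         = ≈-sym (≈-context p q e)
≈-context p q (≈-trans e e′)    = ≈-trans (≈-context p q e) (≈-context p q e′)
≈-context p q (≈-cancel u l v) =
  ≈-trans (≡⇒≈ (reassoc (l ∷ invL l ∷ v)))
          (≈-trans (≈-cancel (p ++ u) l (v ++ q)) (≡⇒≈ (sym (reassoc v))))
  where
  reassoc : ∀ r → p ++ (u ++ r) ++ q ≡ (p ++ u) ++ r ++ q
  reassoc r = trans (cong (p ++_) (++-assoc u r q)) (sym (++-assoc p u (r ++ q)))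

⁻¹-∷ : (l : Letter n) (u : Word n) → (l ∷ u) ⁻¹ ≡ u ⁻¹ ++ invL l ∷ []
⁻¹-∷ l u = unfold-reverse (invL l) (map invL u)

·-inverseʳ : (u : Word n) → (u · u ⁻¹) ≈ []
·-inverseʳ []      = ≈-refl
·-inverseʳ (l ∷ u) =
  ≈-trans (≡⇒≈ (cong (l ∷_) (trans (cong (u ++_) (⁻¹-∷ l u)) (sym (++-assoc u (u ⁻¹) _)))))
          (≈-trans (≈-context (l ∷ []) (invL l ∷ []) (·-inverseʳ u)) (≈-cancel [] l []))

≈ab-refl : (u : Word n) → u ≈ab u
≈ab-refl u = c-resp (≈-sym (·-inverseʳ u)) c-unit

≈ab-respˡ : {u v : Word n} (w : Word n) → u ≈ v → v ≈ab w → u ≈ab w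
≈ab-respˡ w u≈v = c-resp (≈-context [] (w ⁻¹) (≈-sym u≈v))

conjugate-by-R₀-≈ab : (g q : Word n) → InR₀ g → InR₀ q → (g · q · g ⁻¹) ≈ab q
conjugate-by-R₀-≈ab g q g∈R₀ q∈R₀ =
  subst InR₀' (sym (trans (++-assoc g (q ++ g ⁻¹) (q ⁻¹)) (cong (g ++_) (++-assoc q (g ⁻¹) (q ⁻¹)))))
        (c-comm {a = g} {b = q} g∈R₀ q∈R₀)

α-· : (u v : Word n) → α (u · v) ≡ α u +ℤ α v
α-· []      v = sym (+-identityˡ (α v))
α-· (l ∷ u) v = trans (cong (αL l +ℤ_) (α-· u v)) (sym (+-assoc (αL l) (α u) (α v)))

αL-invL : (l : Letter n) → αL (invL l) ≡ - αL l
αL-invL (_ , true)  = refl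
αL-invL (_ , false) = refl

α-⁻¹ : (u : Word n) → α (u ⁻¹) ≡ - α u
α-⁻¹ []      = refl
α-⁻¹ (l ∷ u) = begin
  α ((l ∷ u) ⁻¹)                 ≡⟨ cong α (⁻¹-∷ l u) ⟩
  α (u ⁻¹ ++ invL l ∷ [])        ≡⟨ α-· (u ⁻¹) (invL l ∷ []) ⟩
  α (u ⁻¹) +ℤ (αL (invL l) +ℤ 0ℤ) ≡⟨ cong₂ _+ℤ_ (α-⁻¹ u) (trans (+-identityʳ _) (αL-invL l)) ⟩
  - α u +ℤ - αL l                ≡⟨ +-comm (- α u) (- αL l) ⟩
  - αL l +ℤ - α u                ≡⟨ neg-distrib-+ (αL l) (α u) ⟨
  - α (l ∷ u)                    ∎
  where open ≡-Reasoning

α-applyHom : (f : Fin n → Word m) → (∀ g → α (f g) ≡ 1ℤ) → ∀ w → α (applyHom f w) ≡ α w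
α-applyHom f αf≡1 []                = refl
α-applyHom f αf≡1 ((g , true) ∷ w)  =
  trans (α-· (f g) (applyHom f w)) (cong₂ _+ℤ_ (αf≡1 g) (α-applyHom f αf≡1 w))
α-applyHom f αf≡1 ((g , false) ∷ w) =
  trans (α-· (f g ⁻¹) (applyHom f w))
        (cong₂ _+ℤ_ (trans (α-⁻¹ (f g)) (cong -_ (αf≡1 g))) (α-applyHom f αf≡1 w))

α-σimg : ∀ {k} (i : Fin (suc k)) g → α (σimg i g) ≡ 1ℤ
α-σimg i g with g ≟ inject₁ i
... | yes _ = refl
... | no _ with g ≟ suc i
...   | yes _ = refl
...   | no _  = refl

InR₀-applyHom : (f : Fin n → Word m) → (∀ g → α (f g) ≡ 1ℤ) → ∀ w → InR₀ w → InR₀ (applyHom f w)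
InR₀-applyHom f αf≡1 w w∈R₀ = trans (α-applyHom f αf≡1 w) w∈R₀

InR₀-tAct : (w : Word (suc n)) → InR₀ w → InR₀ (tAct w)
InR₀-tAct w w∈R₀ = cong (1ℤ +ℤ_) (trans (α-· w _) (cong (_+ℤ _) w∈R₀))

applyHom-· : (f : Fin n → Word m) (u v : Word n) → applyHom f (u · v) ≡ applyHom f u · applyHom f v
applyHom-· f []              v = refl
applyHom-· f ((g , true) ∷ u)  v =
  trans (cong (f g ++_) (applyHom-· f u v)) (sym (++-assoc (f g) (applyHom f u) (applyHom f v)))
applyHom-· f ((g , false) ∷ u) v =
  trans (cong (f g ⁻¹ ++_) (applyHom-· f u v)) (sym (++-assoc (f g ⁻¹) (applyHom f u) (applyHom f v)))

applyHom-tAct : (f : Fin (suc n) → Word m) (w : Word (suc n)) →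
                applyHom f (tAct w) ≡ f zero · applyHom f w · f zero ⁻¹
applyHom-tAct f w =
  cong (f zero ++_) (trans (applyHom-· f w (gen zero ⁻¹)) (cong (applyHom f w ++_) (++-identityʳ (f zero ⁻¹))))

σ-suc-tAct : ∀ {k} (i : Fin (suc k)) (a : Word (suc (suc (suc k)))) → σ (suc i) (tAct a) ≡ tAct (σ (suc i) a)
σ-suc-tAct i = applyHom-tAct (σimg (suc i))

σ₀x₀·x₀⁻¹ : ∀ {k} → Word (suc (suc k))
σ₀x₀·x₀⁻¹ = σimg zero zero · gen zero ⁻¹

-- The right-hand side becomes σ₀ (tAct a) after cancelling the two factors x₀⁻¹x₀ around σ₀ a.
σ-zero-tAct : ∀ {k} (a : Word (suc (suc k))) →
              σ zero (tAct a) ≈ (σ₀x₀·x₀⁻¹ · tAct (σ zero a) · σ₀x₀·x₀⁻¹ ⁻¹)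
σ-zero-tAct {k} a =
  ≈-trans (≡⇒≈ (applyHom-tAct (σimg zero) a))
          (≈-sym (≈-trans (≈-cancel (x ∷ y ∷ x⁻ ∷ []) x⁻ ((b ++ x⁻ ∷ []) ++ x ∷ x ∷ y⁻ ∷ x⁻ ∷ []))
                 (≈-trans (≡⇒≈ (cong (λ r → x ∷ y ∷ x⁻ ∷ r) (++-assoc b (x⁻ ∷ []) _)))
                          (≈-cancel (x ∷ y ∷ x⁻ ∷ b) x⁻ (x ∷ y⁻ ∷ x⁻ ∷ [])))))
  where
  b : Word (suc (suc k))
  b = σ zero a
  x x⁻ y y⁻ : Letter (suc (suc k))
  x  = zero , true
  x⁻ = zero , false
  y  = suc zero , true
  y⁻ = suc zero , false

mainTheorem5 : (k : ℕ) (j : Fin (suc k)) (a : Word (suc (suc k))) → InR₀ a → σ j (tAct a) ≈ab tAct (σ j a)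
mainTheorem5 k zero a a∈R₀ =
  ≈ab-respˡ q (σ-zero-tAct a) (conjugate-by-R₀-≈ab σ₀x₀·x₀⁻¹ q refl q∈R₀)
  where
  q : Word (suc (suc k))
  q = tAct (σ zero a)
  q∈R₀ : InR₀ q
  q∈R₀ = InR₀-tAct (σ zero a) (InR₀-applyHom (σimg zero) (α-σimg zero) a a∈R₀)
mainTheorem5 (suc k) (suc i) a _ =
  subst (_≈ab tAct (σ (suc i) a)) (sym (σ-suc-tAct i a)) (≈ab-refl (tAct (σ (suc i) a)))
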